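{- Let $G$ be a finite simple graph on $n \geq 1$ vertices with average degree $d$, minimum degree $\delta$ and maximum degree $\Delta$, and let $k \geq 0$ be an integer. Then \begin{enumerate} \item $sp(G,k) \geq \max\left\{\dfrac{n(k+1)}{2d - 2\delta + k+1},\ \dfrac{n(k+1)}{2\Delta - 2d + k+1}\right\}$; \item $sp(G,k) \leq (k+1)\, sp(G,0)$. \end{enumerate}
   Context: For a graph $G=(V,E)$ and a subset $B \subseteq V$, the spread of $B$ is $sp(B) = \max_{u \in B} \deg(u) - \min_{v \in B} \deg(v)$, where degrees are taken in $G$. For an integer $k \geq 0$, $sp(G,k)$ is the maximum cardinality of a subset $B \subseteq V$ with $sp(B) \leq k$. The average degree is $d = 2|E|/n$. -}

module Defs where

open import Data.Nat using (ℕ; _≤_; _+_; _*_; _<_)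
open import Data.Fin using (Fin)
open import Data.Fin.Subset using (Subset; _∈_; ∣_∣)
open import Data.List using (List; length; filter; map; allFin; concatMap)
open import Data.List.Extrema.Nat using (min; max)
open import Data.Product using (Σ; _×_)
open import Relation.Nullary using (¬_; Dec)
open import Relation.Binary.PropositionalEquality using (_≡_)
open import Relation.Unary using (Decidable)
open import Data.Fin using (toℕ)
import Data.Fin.Properties as FinP
import Data.Integer as ℤ
open import Data.Rational using (ℚ; _/_)
import Data.Nat as ℕ

record SimpleGraph (n : ℕ) : Set₁ where
  field
    Adj     : Fin n → Fin n → Set
    adj?    : ∀ u v → Dec (Adj u v)
    sym     : ∀ {u v} → Adj u v → Adj v u
    irrefl  : ∀ {u} → ¬ Adj u u

module _ {n : ℕ} (G : SimpleGraph n) where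
  open SimpleGraph G

  deg : Fin n → ℕ
  deg v = length (filter (adj? v) (allFin n))

  edgeCount : ℕ
  edgeCount = length (filter (λ p → adjPair? p) (concatMap (λ u → map (λ v → (u , v)) (allFin n)) (allFin n)))
    where
    open import Data.Product using (_,_) renaming (_×_ to _⊗_)
    open import Relation.Nullary using (_×-dec_)
    adjPair? : (p : Fin n ⊗ Fin n) → Dec ((toℕ (Data.Product.proj₁ p) < toℕ (Data.Product.proj₂ p)) × Adj (Data.Product.proj₁ p) (Data.Product.proj₂ p))
    adjPair? (u , v) = (toℕ u ℕ.<? toℕ v) ×-dec adj? u v

  avgDeg : .{{_ : ℕ.NonZero n}} → ℚ
  avgDeg = ℤ.+ (2 * edgeCount) / n

  -- maximum degree Δ and minimum degree δ (for n ≥ 1 these are the actual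
  -- max/min of the degrees: every degree is ≤ n - 1 < n, and ≥ 0)
  maxDeg : ℕ
  maxDeg = max 0 (map deg (allFin n))

  minDeg : ℕ
  minDeg = min n (map deg (allFin n))

  -- sp(B) ≤ k : max_{u∈B} deg u - min_{v∈B} deg v ≤ k
  SpreadAtMost : ℕ → Subset n → Set
  SpreadAtMost k B = ∀ u v → u ∈ B → v ∈ B → deg u ≤ deg v + k

  IsSp : ℕ → ℕ → Set
  IsSp k m = Σ (Subset n) (λ B → SpreadAtMost k B × ∣ B ∣ ≡ m)
           × (∀ B → SpreadAtMost k B → ∣ B ∣ ≤ m)

-- If s = sp(G,k), every window [a, a + k] of consecutive degree values contains at most s
-- vertices. Cutting the degree range into consecutive windows upwards from δ, the i-th window
-- (i = 0, 1, …) holds at most s vertices, each of degree at least δ + i(k+1); hence the n vertices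
-- have degree excess Σ (deg v − δ) ≥ (k+1)(n²/(2s) − n/2), and since Σ deg v = 2|E| = nd this is
-- the first bound. The second is the same argument applied to the values Δ − deg v. For (2), a set
-- of spread at most k has its degrees among k + 1 consecutive values, and for each single value
-- the vertices of that degree form a set of spread 0, so there are at most sp(G,0) of them.
module Submission where

open import Defs

open import Data.Nat.Base as ℕ using (ℕ; suc; NonZero)
import Data.Nat.Properties as ℕ
import Data.Rational as ℚ
import Data.Rational.Properties as ℚ
open import Relation.Binary.PropositionalEquality

-- Embedding ℕ into ℚ

module _ where
  open import Data.Integer.Base as ℤ using (+_)
  import Data.Integer.Properties as ℤ
  open import Data.Integer.Tactic.RingSolver using (solve-∀)
  open import Data.Rational using (ℚ; _/_; fromℚᵘ; _+_; _*_; _-_; _≤_)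
  open import Data.Rational.Properties
    using (toℚᵘ-injective; toℚᵘ-fromℚᵘ; fromℚᵘ-cong; toℚᵘ-cancel-≤; toℚᵘ-homo-+; toℚᵘ-homo-*)
  open import Data.Rational.Solver using (module +-*-Solver)
  open import Data.Rational.Unnormalised as ℚᵘ using (mkℚᵘ; *≡*; *≤*)
  import Data.Rational.Unnormalised.Properties as ℚᵘ

  -- Naturals occur in the statement in exactly this form.
  fromℕ : ℕ → ℚ
  fromℕ m = + m / 1

  fromℚᵘ-homo-+ : ∀ p q → fromℚᵘ (p ℚᵘ.+ q) ≡ fromℚᵘ p + fromℚᵘ q
  fromℚᵘ-homo-+ p q = toℚᵘ-injective (ℚᵘ.≃-trans (toℚᵘ-fromℚᵘ (p ℚᵘ.+ q)) (ℚᵘ.≃-sym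
    (ℚᵘ.≃-trans (toℚᵘ-homo-+ (fromℚᵘ p) (fromℚᵘ q)) (ℚᵘ.+-cong (toℚᵘ-fromℚᵘ p) (toℚᵘ-fromℚᵘ q)))))

  fromℚᵘ-homo-* : ∀ p q → fromℚᵘ (p ℚᵘ.* q) ≡ fromℚᵘ p * fromℚᵘ q
  fromℚᵘ-homo-* p q = toℚᵘ-injective (ℚᵘ.≃-trans (toℚᵘ-fromℚᵘ (p ℚᵘ.* q)) (ℚᵘ.≃-sym
    (ℚᵘ.≃-trans (toℚᵘ-homo-* (fromℚᵘ p) (fromℚᵘ q)) (ℚᵘ.*-cong (toℚᵘ-fromℚᵘ p) (toℚᵘ-fromℚᵘ q)))))

  fromℕ-+ : ∀ m n → fromℕ (m ℕ.+ n) ≡ fromℕ m + fromℕ n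
  fromℕ-+ m n = trans (fromℚᵘ-cong {mkℚᵘ (+ (m ℕ.+ n)) 0} {mkℚᵘ (+ m) 0 ℚᵘ.+ mkℚᵘ (+ n) 0} (*≡* eq))
                      (fromℚᵘ-homo-+ (mkℚᵘ (+ m) 0) (mkℚᵘ (+ n) 0))
    where
    distrib : ∀ a b → (a ℤ.+ b) ℤ.* + 1 ≡ (a ℤ.* + 1 ℤ.+ b ℤ.* + 1) ℤ.* + 1
    distrib = solve-∀
    eq : + (m ℕ.+ n) ℤ.* + 1 ≡ (+ m ℤ.* + 1 ℤ.+ + n ℤ.* + 1) ℤ.* + 1
    eq = trans (cong (ℤ._* + 1) (ℤ.pos-+ m n)) (distrib (+ m) (+ n))

  fromℕ-* : ∀ m n → fromℕ (m ℕ.* n) ≡ fromℕ m * fromℕ n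
  fromℕ-* m n = trans (fromℚᵘ-cong {mkℚᵘ (+ (m ℕ.* n)) 0} {mkℚᵘ (+ m) 0 ℚᵘ.* mkℚᵘ (+ n) 0} (*≡* eq))
                      (fromℚᵘ-homo-* (mkℚᵘ (+ m) 0) (mkℚᵘ (+ n) 0))
    where
    eq : + (m ℕ.* n) ℤ.* + 1 ≡ (+ m ℤ.* + n) ℤ.* + 1
    eq = cong (ℤ._* + 1) (ℤ.pos-* m n)

  fromℕ-mono-≤ : ∀ {m n} → m ℕ.≤ n → fromℕ m ≤ fromℕ n
  fromℕ-mono-≤ {m} {n} m≤n = toℚᵘ-cancel-≤
    (ℚᵘ.≤-respˡ-≃ (ℚᵘ.≃-sym (toℚᵘ-fromℚᵘ (mkℚᵘ (+ m) 0)))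
    (ℚᵘ.≤-respʳ-≃ (ℚᵘ.≃-sym (toℚᵘ-fromℚᵘ (mkℚᵘ (+ n) 0)))
    (*≤* (ℤ.*-monoʳ-≤-nonNeg (+ 1) (ℤ.+≤+ m≤n)))))

  positive-fromℕ : ∀ n .{{_ : NonZero n}} → ℚ.Positive (fromℕ n)
  positive-fromℕ n = ℚ.normalize-pos n 1

  /-*-fromℕ : ∀ m n .{{_ : NonZero n}} → (+ m / n) * fromℕ n ≡ fromℕ m
  /-*-fromℕ m (suc n) = trans (sym (fromℚᵘ-homo-* (mkℚᵘ (+ m) n) (mkℚᵘ (+ suc n) 0)))
                              (fromℚᵘ-cong {mkℚᵘ (+ m) n ℚᵘ.* mkℚᵘ (+ suc n) 0} {mkℚᵘ (+ m) 0} (*≡* eq))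
    where
    eq : (+ m ℤ.* + suc n) ℤ.* + 1 ≡ + m ℤ.* + (suc n ℕ.* 1)
    eq = trans (ℤ.*-identityʳ _) (cong (λ d → + m ℤ.* + d) (sym (ℕ.*-identityʳ (suc n))))

  +≤⇒≤- : ∀ {a b c} → a + b ≤ c → a ≤ c - b
  +≤⇒≤- {a} {b} {c} a+b≤c = subst (_≤ c - b) (+-cancelʳ a b) (ℚ.+-monoˡ-≤ (ℚ.- b) a+b≤c)
    where
    open +-*-Solver
    +-cancelʳ : ∀ a b → (a + b) - b ≡ a
    +-cancelʳ = solve 2 (λ a b → (a :+ b) :- b := a) refl

  ≤-clear-denominator : ∀ (n s K T U : ℕ) .{{_ : NonZero n}} (p q : ℚ) →
    p * fromℕ n ≡ fromℕ T → q * fromℕ n ≡ fromℕ U →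
    n ℕ.* K ℕ.* n ℕ.+ s ℕ.* U ℕ.≤ s ℕ.* T ℕ.+ s ℕ.* K ℕ.* n →
    fromℕ (n ℕ.* K) ≤ fromℕ s * ((p - q) + fromℕ K)
  ≤-clear-denominator n s K T U p q pn≡T qn≡U h = ℚ.*-cancelʳ-≤-pos (ι n) {{positive-fromℕ n}} (begin
    ι (n ℕ.* K) * ι n                                    ≡⟨ fromℕ-* (n ℕ.* K) n ⟨
    ι (n ℕ.* K ℕ.* n)                                    ≤⟨ +≤⇒≤- (subst (_≤ ι sT+sKn) (fromℕ-+ (n ℕ.* K ℕ.* n) (s ℕ.* U)) (fromℕ-mono-≤ h)) ⟩
    ι sT+sKn - ι (s ℕ.* U)                               ≡⟨ cong₂ _-_ expand-sT+sKn (fromℕ-* s U) ⟩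
    ι s * ι T + ι s * ι K * ι n - ι s * ι U              ≡⟨ cong₂ (λ t u → ι s * t + ι s * ι K * ι n - ι s * u) pn≡T qn≡U ⟨
    ι s * (p * ι n) + ι s * ι K * ι n - ι s * (q * ι n)  ≡⟨ regroup (ι s) p q (ι K) (ι n) ⟩
    ι s * ((p - q) + ι K) * ι n                          ∎)
    where
    open ℚ.≤-Reasoning
    open +-*-Solver
    ι = fromℕ
    sT+sKn = s ℕ.* T ℕ.+ s ℕ.* K ℕ.* n
    expand-sT+sKn : ι sT+sKn ≡ ι s * ι T + ι s * ι K * ι n
    expand-sT+sKn = trans (fromℕ-+ (s ℕ.* T) (s ℕ.* K ℕ.* n))
      (cong₂ _+_ (fromℕ-* s T) (trans (fromℕ-* (s ℕ.* K) n) (cong (_* ι n) (fromℕ-* s K))))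
    regroup : ∀ s p q k n → s * (p * n) + s * k * n - s * (q * n) ≡ s * ((p - q) + k) * n
    regroup = solve 5 (λ s p q k n → s :* (p :* n) :+ s :* k :* n :- s :* (q :* n) := s :* ((p :- q) :+ k) :* n) refl

open import Data.Nat
open import Data.Nat.Properties
open import Data.Nat.ListAction using (sum)
open import Data.Nat.ListAction.Properties using (sum-++; sum-↭)
open import Data.Nat.Tactic.RingSolver using (solve-∀)
open import Data.Bool using (Bool; true; false; if_then_else_; _∧_)
open import Data.Fin using (Fin; zero; suc; toℕ)
open import Data.Fin.Properties using (toℕ-injective)
open import Data.Fin.Subset using (Subset; ∣_∣) renaming (_∈_ to _∈ₛ_)
open import Data.Fin.Subset.Properties using (_∈?_)
import Data.Vec as Vec
open import Data.Vec using () renaming (_∷_ to _∷ᵥ_)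
import Data.Vec.Properties as Vec
open import Data.List using (List; []; _∷_; length; filter; map; _++_; allFin; concatMap; tabulate)
open import Data.List.Properties using (length-++; filter-++; filter-all; length-map; length-tabulate; map-tabulate)
open import Data.List.Extrema.Nat using (max; xs≤max; min; min≤⊤; min≤xs; argmin-sel)
open import Data.List.Relation.Unary.All as All using (All; []; _∷_)
open import Data.List.Relation.Unary.All.Properties using (all-filter; filter⁺)
open import Data.List.Relation.Unary.Any using (here; there)
open import Data.List.Membership.Propositional using (_∈_)
open import Data.List.Membership.Propositional.Properties using (∈-map⁻; ∈-filter⁻)
open import Data.List.Relation.Binary.Permutation.Propositional using (_↭_; prep; ↭-trans; ↭-refl)
open import Data.List.Relation.Binary.Permutation.Propositional.Properties using (↭-length; shift)
open import Data.List.Relation.Binary.Sublist.Propositional using (_⊆_)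
import Data.List.Relation.Binary.Sublist.Propositional.Properties as Sublist
open import Algebra.Properties.CommutativeMonoid.Sum +-0-commutativeMonoid
  using (sum-cong-≗; ∑-distrib-+; ∑-comm) renaming (sum to ∑)
open import Data.Product using (_×_; _,_; proj₁; proj₂)
open import Data.Sum using ([_,_]′)
open import Function using (_∘_; id)
open import Relation.Nullary using (Dec; yes; no; ¬_; does; contradiction)
open import Relation.Nullary.Decidable using (_×-dec_)
open import Relation.Unary using (Pred; Decidable)
open import Relation.Unary.Properties using (∁?)

module _ {a p} {A : Set a} {P : Pred A p} (P? : Decidable P) where

  filter-++-filter-∁-↭ : ∀ xs → filter P? xs ++ filter (∁? P?) xs ↭ xs
  filter-++-filter-∁-↭ [] = ↭-refl
  filter-++-filter-∁-↭ (x ∷ xs) with P? x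
  ... | yes _ = prep x (filter-++-filter-∁-↭ xs)
  ... | no _  = ↭-trans (shift x (filter P? xs) (filter (∁? P?) xs)) (prep x (filter-++-filter-∁-↭ xs))

  length-filter-+-filter-∁ : ∀ xs → length (filter P? xs) + length (filter (∁? P?) xs) ≡ length xs
  length-filter-+-filter-∁ xs = trans (sym (length-++ (filter P? xs))) (↭-length (filter-++-filter-∁-↭ xs))

sum-filter-+-filter-∁ : ∀ {p} {P : Pred ℕ p} (P? : Decidable P) xs →
  sum (filter P? xs) + sum (filter (∁? P?) xs) ≡ sum xs
sum-filter-+-filter-∁ P? xs = trans (sym (sum-++ (filter P? xs) _)) (sum-↭ (filter-++-filter-∁-↭ P? xs))

length-filter-map-≤ : ∀ {a b p q} {A : Set a} {B : Set b} {P : Pred B p} {Q : Pred A q}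
  (P? : Decidable P) (Q? : Decidable Q) (f : A → B) {xs} → All (λ x → P (f x) → Q x) xs →
  length (filter P? (map f xs)) ≤ length (filter Q? xs)
length-filter-map-≤ P? Q? f [] = z≤n
length-filter-map-≤ P? Q? f {x ∷ xs} (imp ∷ imps) with P? (f x) | Q? x
... | yes _  | yes _  = s≤s (length-filter-map-≤ P? Q? f imps)
... | yes pf | no ¬qx = contradiction (imp pf) ¬qx
... | no _   | yes _  = m≤n⇒m≤1+n (length-filter-map-≤ P? Q? f imps)
... | no _   | no _   = length-filter-map-≤ P? Q? f imps

sum-map-∸ : ∀ {C} xs → All (_≤ C) xs → sum (map (C ∸_) xs) + sum xs ≡ length xs * C
sum-map-∸ [] [] = refl
sum-map-∸ {C} (x ∷ xs) (x≤C ∷ xs≤C) = begin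
  (C ∸ x + sum (map (C ∸_) xs)) + (x + sum xs) ≡⟨ interchange (C ∸ x) _ x _ ⟩
  (C ∸ x + x) + (sum (map (C ∸_) xs) + sum xs) ≡⟨ cong₂ _+_ (m∸n+n≡m x≤C) (sum-map-∸ xs xs≤C) ⟩
  C + length xs * C ∎
  where
  open ≡-Reasoning
  interchange : ∀ a b c d → (a + b) + (c + d) ≡ (a + c) + (b + d)
  interchange = solve-∀

length*≤sum : ∀ {c} xs → All (c ≤_) xs → length xs * c ≤ sum xs
length*≤sum []       []         = z≤n
length*≤sum (x ∷ xs) (c≤x ∷ cs) = +-mono-≤ c≤x (length*≤sum xs cs)

-- Counting in windows of consecutive values

InWindow : ℕ → ℕ → ℕ → Set
InWindow a k x = a ≤ x × x ≤ a + k

inWindow? : ∀ a k → Decidable (InWindow a k)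
inWindow? a k x = (a ≤? x) ×-dec (x ≤? a + k)

windowCount : ℕ → ℕ → List ℕ → ℕ
windowCount a k xs = length (filter (inWindow? a k) xs)

WindowCountsAtMost : ℕ → ℕ → List ℕ → Set
WindowCountsAtMost s k xs = ∀ a → windowCount a k xs ≤ s

windowCount-mono-⊆ : ∀ a k {xs ys} → xs ⊆ ys → windowCount a k xs ≤ windowCount a k ys
windowCount-mono-⊆ a k xs⊆ys =
  Sublist.length-mono-≤ (Sublist.filter⁺ (inWindow? a k) (inWindow? a k) (λ { refl w → w }) xs⊆ys)

windowCount-filter-≤ : ∀ {p} {P : Pred ℕ p} (P? : Decidable P) a k xs →
  windowCount a k (filter P? xs) ≤ windowCount a k xs
windowCount-filter-≤ P? a k xs = windowCount-mono-⊆ a k (Sublist.filter-⊆ P? xs)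

above-window : ∀ {a k x} → a ≤ x → ¬ InWindow a k x → a + suc k ≤ x
above-window {a} {k} {x} a≤x x∉w with x ≤? a + k
... | yes x≤a+k = contradiction (a≤x , x≤a+k) x∉w
... | no  x≰a+k = subst (_≤ x) (sym (+-suc a k)) (≰⇒> x≰a+k)

∸-window : ∀ {a k C x} → x ≤ C → InWindow a k (C ∸ x) → InWindow (C ∸ (a + k)) k x
∸-window {a} {k} {C} {x} x≤C (a≤C∸x , C∸x≤a+k) =
    subst (C ∸ (a + k) ≤_) (m∸[m∸n]≡n x≤C) (∸-monoʳ-≤ C C∸x≤a+k)
  , (begin
      x                    ≤⟨ m+n≤o⇒m≤o∸n x (subst (x + a ≤_) (m+[n∸m]≡n x≤C) (+-monoʳ-≤ x a≤C∸x)) ⟩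
      C ∸ a                ≤⟨ m≤n+m∸n (C ∸ a) k ⟩
      k + (C ∸ a ∸ k)      ≡⟨ cong (k +_) (∸-+-assoc C a k) ⟩
      k + (C ∸ (a + k))    ≡⟨ +-comm k _ ⟩
      C ∸ (a + k) + k      ∎)
  where open ≤-Reasoning

-- The bounds below read n²K ≤ 2s(Σ − nc) + snK with the subtraction moved across. This is the
-- inductive step: m ≤ s elements of sum S₁ ≥ mc in the lowest window, p elements of sum S₂ above it.
length²-step : ∀ s K c m p S₁ S₂ → m ≤ s → m * c ≤ S₁ →
  p * K * p + s * (2 * (c + K) * p) ≤ s * (2 * S₂) + s * K * p →
  (m + p) * K * (m + p) + s * (2 * c * (m + p)) ≤ s * (2 * (S₁ + S₂)) + s * K * (m + p)
length²-step s K c m p S₁ S₂ m≤s mc≤S₁ ih = begin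
  (m + p) * K * (m + p) + s * (2 * c * (m + p))           ≡⟨ expand s K c m p ⟩
  (p * K * p + s * (2 * c * p) + 2 * s * (m * c)) + (m * m + 2 * m * p) * K
    ≤⟨ +-monoʳ-≤ (p * K * p + s * (2 * c * p) + 2 * s * (m * c))
         (*-monoˡ-≤ K (+-mono-≤ (*-monoˡ-≤ m m≤s) (*-monoˡ-≤ p (*-monoʳ-≤ 2 m≤s)))) ⟩
  (p * K * p + s * (2 * c * p) + 2 * s * (m * c)) + (s * m + 2 * s * p) * K ≡⟨ regroup s K c m p ⟩
  (p * K * p + s * (2 * (c + K) * p)) + (2 * s * (m * c) + s * K * m)
    ≤⟨ +-mono-≤ ih (+-monoˡ-≤ (s * K * m) (*-monoʳ-≤ (2 * s) mc≤S₁)) ⟩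
  (s * (2 * S₂) + s * K * p) + (2 * s * S₁ + s * K * m) ≡⟨ collect s K m p S₁ S₂ ⟩
  s * (2 * (S₁ + S₂)) + s * K * (m + p) ∎
  where
  open ≤-Reasoning
  expand : ∀ s K c m p → (m + p) * K * (m + p) + s * (2 * c * (m + p))
    ≡ (p * K * p + s * (2 * c * p) + 2 * s * (m * c)) + (m * m + 2 * m * p) * K
  expand = solve-∀
  regroup : ∀ s K c m p → (p * K * p + s * (2 * c * p) + 2 * s * (m * c)) + (s * m + 2 * s * p) * K
    ≡ (p * K * p + s * (2 * (c + K) * p)) + (2 * s * (m * c) + s * K * m)
  regroup = solve-∀
  collect : ∀ s K m p S₁ S₂ → (s * (2 * S₂) + s * K * p) + (2 * s * S₁ + s * K * m)
    ≡ s * (2 * (S₁ + S₂)) + s * K * (m + p)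
  collect = solve-∀

module _ (s k : ℕ) where

  -- The elements lie in the first b windows of width k + 1 above c; induction on b.
  length²-bound-height : ∀ b c xs → All (c ≤_) xs → All (_< c + b * suc k) xs → WindowCountsAtMost s k xs →
    length xs * suc k * length xs + s * (2 * c * length xs) ≤ s * (2 * sum xs) + s * suc k * length xs
  length²-bound-height _ c [] _ _ _ = ≤-reflexive (empty s k c)
    where
    empty : ∀ s k c → 0 * suc k * 0 + s * (2 * c * 0) ≡ s * (2 * 0) + s * suc k * 0
    empty = solve-∀
  length²-bound-height zero c (x ∷ xs) (c≤x ∷ _) (x<c+0 ∷ _) _ =
    contradiction (subst (x <_) (+-identityʳ c) x<c+0) (≤⇒≯ c≤x)
  length²-bound-height (suc b) c xs c≤xs xs<top counts =
    subst₂ (λ n S → n * suc k * n + s * (2 * c * n) ≤ s * (2 * S) + s * suc k * n)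
      (length-filter-+-filter-∁ low? xs) (sum-filter-+-filter-∁ low? xs)
      (length²-step s (suc k) c _ _ _ _ (counts c) (length*≤sum _ low≥c) high-bound)
    where
    low? = inWindow? c k
    high = filter (∁? low?) xs
    low≥c : All (c ≤_) (filter low? xs)
    low≥c = All.map proj₁ (all-filter low? xs)
    high-bound : length high * suc k * length high + s * (2 * (c + suc k) * length high)
               ≤ s * (2 * sum high) + s * suc k * length high
    high-bound = length²-bound-height b (c + suc k) high
      (All.zipWith (λ (c≤x , x∉w) → above-window c≤x x∉w) (filter⁺ (∁? low?) c≤xs , all-filter (∁? low?) xs))
      (filter⁺ (∁? low?) (All.map (λ {x} → subst (x <_) (sym (+-assoc c (suc k) (b * suc k)))) xs<top))
      (λ a → ≤-trans (windowCount-filter-≤ (∁? low?) a k xs) (counts a))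

  length²-bound-below : ∀ c xs → All (c ≤_) xs → WindowCountsAtMost s k xs →
    length xs * suc k * length xs + s * (2 * c * length xs) ≤ s * (2 * sum xs) + s * suc k * length xs
  length²-bound-below c xs c≤xs = length²-bound-height (suc M) c xs c≤xs (All.map below-top (xs≤max 0 xs))
    where
    M = max 0 xs
    below-top : ∀ {x} → x ≤ M → x < c + suc M * suc k
    below-top x≤M = ≤-trans (s≤s x≤M) (≤-trans (m≤m*n (suc M) (suc k)) (m≤n+m _ c))

  length²-bound-above : ∀ C xs → All (_≤ C) xs → WindowCountsAtMost s k xs →
    length xs * suc k * length xs + s * (2 * sum xs) ≤ s * (2 * C * length xs) + s * suc k * length xs
  length²-bound-above C xs xs≤C counts = begin
    n * suc k * n + s * (2 * sum xs)                          ≡⟨ add-zero s k n (s * (2 * sum xs)) ⟩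
    (n * suc k * n + s * (2 * 0 * n)) + s * (2 * sum xs)
      ≤⟨ +-monoˡ-≤ (s * (2 * sum xs)) (subst (λ m → m * suc k * m + s * (2 * 0 * m) ≤ s * (2 * sum ys) + s * suc k * m)
           (length-map (C ∸_) xs) (length²-bound-below 0 ys (All.universal (λ _ → z≤n) ys) ys-counts)) ⟩
    (s * (2 * sum ys) + s * suc k * n) + s * (2 * sum xs)   ≡⟨ collect s k n (sum ys) (sum xs) ⟩
    s * (2 * (sum ys + sum xs)) + s * suc k * n              ≡⟨ cong (λ t → s * (2 * t) + s * suc k * n) (sum-map-∸ xs xs≤C) ⟩
    s * (2 * (n * C)) + s * suc k * n                        ≡⟨ cong (λ t → s * t + s * suc k * n) (reorder n C) ⟩
    s * (2 * C * n) + s * suc k * n ∎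
    where
    open ≤-Reasoning
    n = length xs
    ys = map (C ∸_) xs
    ys-counts : WindowCountsAtMost s k ys
    ys-counts a = ≤-trans (length-filter-map-≤ (inWindow? a k) (inWindow? (C ∸ (a + k)) k) (C ∸_)
      (All.map ∸-window xs≤C)) (counts (C ∸ (a + k)))
    add-zero : ∀ s k n t → n * suc k * n + t ≡ (n * suc k * n + s * (2 * 0 * n)) + t
    add-zero = solve-∀
    collect : ∀ s k n u v → (s * (2 * u) + s * suc k * n) + s * (2 * v) ≡ s * (2 * (u + v)) + s * suc k * n
    collect = solve-∀
    reorder : ∀ n C → 2 * (n * C) ≡ 2 * C * n
    reorder = solve-∀

windowCount-all : ∀ {a k xs} → All (InWindow a k) xs → windowCount a k xs ≡ length xs
windowCount-all {a} {k} xs∈w = cong length (filter-all (inWindow? a k) xs∈w)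

length≤suc*-windowed : ∀ t k a xs → All (InWindow a k) xs → WindowCountsAtMost t 0 xs → length xs ≤ suc k * t
length≤suc*-windowed t zero a xs xs∈w counts = begin
  length xs         ≡⟨ windowCount-all xs∈w ⟨
  windowCount a 0 xs ≤⟨ counts a ⟩
  t                 ≡⟨ +-identityʳ t ⟨
  1 * t             ∎
  where open ≤-Reasoning
length≤suc*-windowed t (suc k) a xs xs∈w counts = begin
  length xs                     ≡⟨ length-filter-+-filter-∁ lower? xs ⟨
  length lower + length upper   ≤⟨ +-mono-≤ lower-bound upper-bound ⟩
  suc k * t + t                 ≡⟨ +-comm (suc k * t) t ⟩
  suc (suc k) * t               ∎
  where
  open ≤-Reasoning
  lower? = λ x → x ≤? a + k
  lower = filter lower? xs
  upper = filter (∁? lower?) xs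
  lower-bound : length lower ≤ suc k * t
  lower-bound = length≤suc*-windowed t k a lower
    (All.zipWith (λ ((a≤x , _) , x≤a+k) → a≤x , x≤a+k) (filter⁺ lower? xs∈w , all-filter lower? xs))
    (λ b → ≤-trans (windowCount-filter-≤ lower? b 0 xs) (counts b))
  upper∈w : All (InWindow (a + suc k) 0) upper
  upper∈w = All.zipWith top (filter⁺ (∁? lower?) xs∈w , all-filter (∁? lower?) xs)
    where
    top : ∀ {x} → InWindow a (suc k) x × ¬ x ≤ a + k → InWindow (a + suc k) 0 x
    top {x} ((_ , x≤a+1+k) , x≰a+k) =
      subst (_≤ x) (sym (+-suc a k)) (≰⇒> x≰a+k) , subst (x ≤_) (sym (+-identityʳ (a + suc k))) x≤a+1+k
  upper-bound : length upper ≤ t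
  upper-bound = begin
    length upper                       ≡⟨ windowCount-all upper∈w ⟨
    windowCount (a + suc k) 0 upper    ≤⟨ windowCount-filter-≤ (∁? lower?) (a + suc k) 0 xs ⟩
    windowCount (a + suc k) 0 xs       ≤⟨ counts (a + suc k) ⟩
    t                                  ∎

length≤suc*-spread : ∀ t k xs → (∀ {x y} → x ∈ xs → y ∈ xs → x ≤ y + k) → WindowCountsAtMost t 0 xs →
  length xs ≤ suc k * t
length≤suc*-spread t k [] spread counts = z≤n
length≤suc*-spread t k (x ∷ xs) spread counts = length≤suc*-windowed t k a (x ∷ xs) (All.tabulate in-window) counts
  where
  a = min x xs
  a≤all : All (a ≤_) (x ∷ xs)
  a≤all = min≤⊤ x xs ∷ min≤xs x xs
  a∈ : a ∈ x ∷ xs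
  a∈ = [ here , there ]′ (argmin-sel (λ z → z) x xs)
  in-window : ∀ {y} → y ∈ x ∷ xs → InWindow a k y
  in-window y∈ = All.lookup a≤all y∈ , spread y∈ a∈

-- Counting over Fin n

fromBool : Bool → ℕ
fromBool b = if b then 1 else 0

module _ {a p} {A : Set a} {P : Pred A p} (P? : Decidable P) where

  length-filter-tabulate : ∀ {n} (g : Fin n → A) → length (filter P? (tabulate g)) ≡ ∑ (λ i → fromBool (does (P? (g i))))
  length-filter-tabulate {zero} g = refl
  length-filter-tabulate {suc n} g with does (P? (g zero))
  ... | true  = cong suc (length-filter-tabulate (g ∘ suc))
  ... | false = length-filter-tabulate (g ∘ suc)

  length-filter-concatMap : ∀ {b} {B : Set b} {n} (f : B → List A) (g : Fin n → B) →
    length (filter P? (concatMap f (tabulate g))) ≡ ∑ (λ i → length (filter P? (f (g i))))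
  length-filter-concatMap {n = zero} f g = refl
  length-filter-concatMap {n = suc n} f g = begin
    length (filter P? (f (g zero) ++ concatMap f (tabulate (g ∘ suc))))
      ≡⟨ cong length (filter-++ P? (f (g zero)) _) ⟩
    length (filter P? (f (g zero)) ++ filter P? (concatMap f (tabulate (g ∘ suc))))
      ≡⟨ length-++ (filter P? (f (g zero))) ⟩
    length (filter P? (f (g zero))) + length (filter P? (concatMap f (tabulate (g ∘ suc))))
      ≡⟨ cong (length (filter P? (f (g zero))) +_) (length-filter-concatMap f (g ∘ suc)) ⟩
    ∑ (λ i → length (filter P? (f (g i)))) ∎
    where open ≡-Reasoning

  ∣tabulate∣≡length-filter : ∀ {n} (g : Fin n → A) →
    ∣ Vec.tabulate (λ i → does (P? (g i))) ∣ ≡ length (filter P? (tabulate g))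
  ∣tabulate∣≡length-filter {zero} g = refl
  ∣tabulate∣≡length-filter {suc n} g with does (P? (g zero))
  ... | true  = cong suc (∣tabulate∣≡length-filter (g ∘ suc))
  ... | false = ∣tabulate∣≡length-filter (g ∘ suc)

length-filter-pairs : ∀ {n p} {P : Pred (Fin n × Fin n) p} (P? : Decidable P) →
  length (filter P? (concatMap (λ u → map (u ,_) (allFin n)) (allFin n))) ≡ ∑ (λ u → ∑ (λ v → fromBool (does (P? (u , v)))))
length-filter-pairs {n} P? = trans (length-filter-concatMap P? (λ u → map (u ,_) (allFin n)) id)
  (sum-cong-≗ (λ u → trans (cong (length ∘ filter P?) (map-tabulate id (u ,_))) (length-filter-tabulate P? (u ,_))))

∈-tabulate⁻ : ∀ {n p} {P : Pred (Fin n) p} (P? : Decidable P) {v} → v ∈ₛ Vec.tabulate (λ i → does (P? i)) → P v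
∈-tabulate⁻ P? {v} v∈ with P? v | trans (sym (Vec.lookup∘tabulate (λ i → does (P? i)) v)) (Vec.[]=⇒lookup v∈)
... | yes pv | _ = pv
... | no _   | ()

does-∈? : ∀ {n} (B : Subset n) v → does (v ∈? B) ≡ Vec.lookup B v
does-∈? (true ∷ᵥ B)  zero    = refl
does-∈? (false ∷ᵥ B) zero    = refl
does-∈? (_ ∷ᵥ B)     (suc v) = does-∈? B v

length-filter-∈? : ∀ {n} (B : Subset n) → length (filter (_∈? B) (allFin n)) ≡ ∣ B ∣
length-filter-∈? B = begin
  length (filter (_∈? B) (allFin _))              ≡⟨ ∣tabulate∣≡length-filter (_∈? B) id ⟨
  ∣ Vec.tabulate (λ v → does (v ∈? B)) ∣          ≡⟨ cong ∣_∣ (trans (Vec.tabulate-cong (does-∈? B)) (Vec.tabulate∘lookup B)) ⟩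
  ∣ B ∣ ∎
  where open ≡-Reasoning

sum-map-tabulate : ∀ {a} {A : Set a} {n} (f : A → ℕ) (g : Fin n → A) → sum (map f (tabulate g)) ≡ ∑ (f ∘ g)
sum-map-tabulate {n = zero}  f g = refl
sum-map-tabulate {n = suc n} f g = cong (f (g zero) +_) (sum-map-tabulate f (g ∘ suc))

fromBool-split-< : ∀ {m n} (b : Bool) → (b ≡ true → m ≢ n) → (m<n? : Dec (m < n)) (n<m? : Dec (n < m)) →
  fromBool b ≡ fromBool (does m<n? ∧ b) + fromBool (does n<m? ∧ b)
fromBool-split-< _     _   (yes m<n) (yes n<m) = contradiction n<m (<-asym m<n)
fromBool-split-< b     _   (yes _)   (no _)    = sym (+-identityʳ (fromBool b))
fromBool-split-< _     _   (no _)    (yes _)   = refl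
fromBool-split-< false _   (no _)    (no _)    = refl
fromBool-split-< true  m≢n (no m≮n)  (no n≮m)  = contradiction (≤-antisym (≮⇒≥ n≮m) (≮⇒≥ m≮n)) (m≢n refl)

-- Degrees of a graph

module _ {n : ℕ} (G : SimpleGraph n) where
  open SimpleGraph G using (Adj; adj?; irrefl) renaming (sym to adj-sym)

  degrees : List ℕ
  degrees = map (deg G) (allFin n)

  length-degrees : length degrees ≡ n
  length-degrees = trans (length-map (deg G) (allFin n)) (length-tabulate id)

  private
    does-adj-sym : ∀ u v → does (adj? u v) ≡ does (adj? v u)
    does-adj-sym u v with adj? u v | adj? v u
    ... | yes _  | yes _  = refl
    ... | yes uv | no ¬vu = contradiction (adj-sym uv) ¬vu
    ... | no ¬uv | yes vu = contradiction (adj-sym vu) ¬uv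
    ... | no _   | no _   = refl

    -- Definitionally the summand of edgeCount G in length-filter-pairs.
    Edge : Fin n → Fin n → ℕ
    Edge u v = fromBool (does (toℕ u <? toℕ v) ∧ does (adj? u v))

    adjacent≡edge+edge : ∀ u v → fromBool (does (adj? u v)) ≡ Edge u v + Edge v u
    adjacent≡edge+edge u v = begin
      fromBool (does (adj? u v))
        ≡⟨ fromBool-split-< (does (adj? u v)) distinct (toℕ u <? toℕ v) (toℕ v <? toℕ u) ⟩
      Edge u v + fromBool (does (toℕ v <? toℕ u) ∧ does (adj? u v))
        ≡⟨ cong (λ b → Edge u v + fromBool (does (toℕ v <? toℕ u) ∧ b)) (does-adj-sym u v) ⟩
      Edge u v + Edge v u ∎
      where
      open ≡-Reasoning
      distinct : does (adj? u v) ≡ true → toℕ u ≢ toℕ v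
      distinct adjacent with adj? u v
      ... | yes uv = λ u≡v → irrefl (subst (Adj u) (sym (toℕ-injective u≡v)) uv)
      distinct () | no _

    edgeCount≡∑ : edgeCount G ≡ ∑ (λ u → ∑ (λ v → Edge u v))
    edgeCount≡∑ = length-filter-pairs {n} _

  handshake : sum degrees ≡ 2 * edgeCount G
  handshake = begin
    sum degrees                                          ≡⟨ sum-map-tabulate (deg G) id ⟩
    ∑ (deg G)                                            ≡⟨ sum-cong-≗ (λ u → length-filter-tabulate (adj? u) id) ⟩
    ∑ (λ u → ∑ (λ v → fromBool (does (adj? u v))))       ≡⟨ sum-cong-≗ (λ u → sum-cong-≗ (adjacent≡edge+edge u)) ⟩
    ∑ (λ u → ∑ (λ v → Edge u v + Edge v u))              ≡⟨ sum-cong-≗ (λ u → ∑-distrib-+ (Edge u) (λ v → Edge v u)) ⟩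
    ∑ (λ u → ∑ (Edge u) + ∑ (λ v → Edge v u))            ≡⟨ ∑-distrib-+ (λ u → ∑ (Edge u)) (λ u → ∑ (λ v → Edge v u)) ⟩
    E + ∑ (λ u → ∑ (λ v → Edge v u))                     ≡⟨ cong (E +_) (∑-comm Edge) ⟨
    E + E                                                ≡⟨ cong (λ e → e + e) edgeCount≡∑ ⟨
    edgeCount G + edgeCount G                            ≡⟨ cong (edgeCount G +_) (+-identityʳ _) ⟨
    2 * edgeCount G                                      ∎
    where
    open ≡-Reasoning
    E = ∑ (λ u → ∑ (Edge u))

  windowCounts-degrees : ∀ {k s} → IsSp G k s → WindowCountsAtMost s k degrees
  windowCounts-degrees {k} {s} (_ , maximal) a = begin
    windowCount a k degrees                     ≤⟨ length-filter-map-≤ (inWindow? a k) inWindow-deg? (deg G) (All.universal (λ _ → id) (allFin n)) ⟩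
    length (filter inWindow-deg? (allFin n))    ≡⟨ ∣tabulate∣≡length-filter inWindow-deg? id ⟨
    ∣ W ∣                                       ≤⟨ maximal W W-spread ⟩
    s                                           ∎
    where
    open ≤-Reasoning
    inWindow-deg? : Decidable (λ v → InWindow a k (deg G v))
    inWindow-deg? v = inWindow? a k (deg G v)
    W : Subset n
    W = Vec.tabulate (λ v → does (inWindow-deg? v))
    W-spread : SpreadAtMost G k W
    W-spread u v u∈W v∈W = ≤-trans (proj₂ (∈-tabulate⁻ inWindow-deg? u∈W)) (+-monoˡ-≤ k (proj₁ (∈-tabulate⁻ inWindow-deg? v∈W)))

  degreesIn : Subset n → List ℕ
  degreesIn B = map (deg G) (filter (_∈? B) (allFin n))

  spk≤suc[k]*sp0 : ∀ {k spk sp0} → IsSp G k spk → IsSp G 0 sp0 → spk ≤ suc k * sp0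
  spk≤suc[k]*sp0 {k} {spk} {sp0} ((B , B-spread , ∣B∣≡spk) , _) sp0-isSp =
    subst (_≤ suc k * sp0) (trans length-degreesIn ∣B∣≡spk) (length≤suc*-spread sp0 k (degreesIn B) spread counts)
    where
    length-degreesIn : length (degreesIn B) ≡ ∣ B ∣
    length-degreesIn = trans (length-map (deg G) (filter (_∈? B) (allFin n))) (length-filter-∈? B)
    spread : ∀ {x y} → x ∈ degreesIn B → y ∈ degreesIn B → x ≤ y + k
    spread x∈ y∈ with ∈-map⁻ (deg G) x∈ | ∈-map⁻ (deg G) y∈
    ... | u , u∈ , refl | v , v∈ , refl =
      B-spread u v (proj₂ (∈-filter⁻ (_∈? B) {xs = allFin n} u∈)) (proj₂ (∈-filter⁻ (_∈? B) {xs = allFin n} v∈))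
    counts : WindowCountsAtMost sp0 0 (degreesIn B)
    counts a = ≤-trans (windowCount-mono-⊆ a 0 (Sublist.map⁺ (deg G) (Sublist.filter-⊆ (_∈? B) (allFin n))))
                       (windowCounts-degrees sp0-isSp a)

  degree-excess-bound : ∀ {k s} → IsSp G k s →
    n * suc k * n + s * (2 * minDeg G * n) ≤ s * (2 * (2 * edgeCount G)) + s * suc k * n
  degree-excess-bound {k} {s} isSp =
    subst₂ (λ m S → m * suc k * m + s * (2 * minDeg G * m) ≤ s * (2 * S) + s * suc k * m) length-degrees handshake
      (length²-bound-below s k (minDeg G) degrees (min≤xs n degrees) (windowCounts-degrees isSp))

  degree-deficit-bound : ∀ {k s} → IsSp G k s →
    n * suc k * n + s * (2 * (2 * edgeCount G)) ≤ s * (2 * maxDeg G * n) + s * suc k * n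
  degree-deficit-bound {k} {s} isSp =
    subst₂ (λ m S → m * suc k * m + s * (2 * S) ≤ s * (2 * maxDeg G * m) + s * suc k * m) length-degrees handshake
      (length²-bound-above s k (maxDeg G) degrees (xs≤max 0 degrees) (windowCounts-degrees isSp))

open import Data.Integer using (+_)

theorem2p1 : (n : ℕ) → .{{_ : NonZero n}} → (G : SimpleGraph n) → (k : ℕ) →
    (spk sp0 : ℕ) → IsSp G k spk → IsSp G 0 sp0 →
      ((ℚ._≤_ (ℚ._/_ (+ (n * suc k)) 1)
              (ℚ._*_ (ℚ._/_ (+ spk) 1)
                (ℚ._+_ (ℚ._-_ (ℚ._*_ (ℚ._/_ (+ 2) 1) (avgDeg G)) (ℚ._/_ (+ (2 * minDeg G)) 1)) (ℚ._/_ (+ (suc k)) 1))))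
       × (ℚ._≤_ (ℚ._/_ (+ (n * suc k)) 1)
              (ℚ._*_ (ℚ._/_ (+ spk) 1)
                (ℚ._+_ (ℚ._-_ (ℚ._/_ (+ (2 * maxDeg G)) 1) (ℚ._*_ (ℚ._/_ (+ 2) 1) (avgDeg G))) (ℚ._/_ (+ (suc k)) 1)))))
      × spk ≤ suc k * sp0
theorem2p1 n G k spk sp0 isSpk isSp0 =
    ( ≤-clear-denominator n spk (suc k) (2 * (2 * edgeCount G)) (2 * minDeg G * n) twice-avgDeg (fromℕ (2 * minDeg G))
        twice-avgDeg*n (sym (fromℕ-* (2 * minDeg G) n)) (degree-excess-bound G isSpk)
    , ≤-clear-denominator n spk (suc k) (2 * maxDeg G * n) (2 * (2 * edgeCount G)) (fromℕ (2 * maxDeg G)) twice-avgDeg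
        (sym (fromℕ-* (2 * maxDeg G) n)) twice-avgDeg*n (degree-deficit-bound G isSpk) )
  , spk≤suc[k]*sp0 G isSpk isSp0
  where
  twice-avgDeg : ℚ.ℚ
  twice-avgDeg = fromℕ 2 ℚ.* avgDeg G
  twice-avgDeg*n : twice-avgDeg ℚ.* fromℕ n ≡ fromℕ (2 * (2 * edgeCount G))
  twice-avgDeg*n = begin
    fromℕ 2 ℚ.* avgDeg G ℚ.* fromℕ n     ≡⟨ ℚ.*-assoc (fromℕ 2) (avgDeg G) (fromℕ n) ⟩
    fromℕ 2 ℚ.* (avgDeg G ℚ.* fromℕ n)   ≡⟨ cong (fromℕ 2 ℚ.*_) (/-*-fromℕ (2 * edgeCount G) n) ⟩
    fromℕ 2 ℚ.* fromℕ (2 * edgeCount G)  ≡⟨ fromℕ-* 2 (2 * edgeCount G) ⟨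
    fromℕ (2 * (2 * edgeCount G))        ∎
    where open ≡-Reasoning
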